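{- Let $G$ be a connected (simple) graph with maximum degree at most $3$ that has a vertex of degree at most two. Then $\kappa_E(G,4)=1$, i.e., any two $4$-edge-colourings of $G$ are Kempe equivalent.
   Context: A $k$-edge-colouring of a graph $G$ is an assignment of colours from $\{1,\ldots,k\}$ to the edges of $G$ such that adjacent edges receive different colours. Given a $k$-edge-colouring and two colours $a,b$, a Kempe change is the operation of interchanging $a$ and $b$ on one connected component of the subgraph formed by the edges coloured $a$ or $b$. Two $k$-edge-colourings are Kempe equivalent if one can be obtained from the other by a sequence of Kempe changes; colourings differing only by a permutation of colours are regarded as the same. $\kappa_E(G,k)$ is the number of Kempe equivalence classes of $k$-edge-colourings of $G$. -}

module Defs where

open import Data.Nat using (ℕ; _≤_)
open import Data.Fin using (Fin)
open import Data.Bool using (Bool; true; false; T)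
open import Data.List using (List; length; filter; allFin)
open import Data.Product using (Σ; ∃; _×_; _,_)
open import Data.Sum using (_⊎_)
open import Data.Empty using (⊥)
open import Relation.Nullary using (¬_)
open import Relation.Nullary.Decidable using (does)
open import Relation.Binary.PropositionalEquality using (_≡_)
open import Function.Bundles using (_↔_)

-- A finite simple graph on vertex set Fin n, adjacency given by a Bool-valued
-- symmetric irreflexive relation.  (Bool-valued so that edge witnesses
-- T (adj u v) are proof-irrelevant.)
record Graph (n : ℕ) : Set where
  field
    adj     : Fin n → Fin n → Bool
    symmetric   : ∀ u v → adj u v ≡ adj v u
    irreflexive : ∀ u → adj u u ≡ false
open Graph public

Edge : ∀ {n} → Graph n → Fin n → Fin n → Set
Edge G u v = T (adj G u v)

degree : ∀ {n} → Graph n → Fin n → ℕ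
degree {n} G u = length (filter (λ v → Data.Bool._≟_ (adj G u v) true) (allFin n))
  where import Data.Bool

data Reach {n} (G : Graph n) : Fin n → Fin n → Set where
  here : ∀ {u} → Reach G u u
  step : ∀ {u v w} → Edge G u v → Reach G v w → Reach G u w

Connected : ∀ {n} → Graph n → Set
Connected {n} G = ∀ (u v : Fin n) → Reach G u v

record EdgeColouring {n} (G : Graph n) (k : ℕ) : Set where
  field
    col    : ∀ u v → Edge G u v → Fin k
    col-sym : ∀ u v (e : Edge G u v) (e' : Edge G v u) → col u v e ≡ col v u e'
    proper : ∀ u v w (e : Edge G u v) (e' : Edge G u w) →
             ¬ (v ≡ w) → ¬ (col u v e ≡ col u w e')
open EdgeColouring public

_≈c_ : ∀ {n} {G : Graph n} {k} → EdgeColouring G k → EdgeColouring G k → Set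
_≈c_ {n} {G} c d = ∀ u v (e : Edge G u v) → col c u v e ≡ col d u v e

data ReachAB {n} {G : Graph n} {k} (c : EdgeColouring G k) (a b : Fin k)
     : Fin n → Fin n → Set where
  here : ∀ {u} → ReachAB c a b u u
  step : ∀ {u v w} (e : Edge G u v) → (col c u v e ≡ a ⊎ col c u v e ≡ b) →
         ReachAB c a b v w → ReachAB c a b u w

-- d is obtained from c by a Kempe change: interchanging colours a and b on the
-- connected component of the (a,b)-subgraph containing the vertex x
-- (a component consisting of x alone gives the trivial change).
KempeChange : ∀ {n} {G : Graph n} {k} → EdgeColouring G k → EdgeColouring G k → Set
KempeChange {n} {G} {k} c d =
  Σ (Fin k) λ a → Σ (Fin k) λ b → Σ (Fin n) λ x →
    ∀ u v (e : Edge G u v) →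
      (ReachAB c a b x u → col c u v e ≡ a → col d u v e ≡ b) ×
      (ReachAB c a b x u → col c u v e ≡ b → col d u v e ≡ a) ×
      ((¬ ReachAB c a b x u ⊎ (¬ col c u v e ≡ a × ¬ col c u v e ≡ b)) →
        col d u v e ≡ col c u v e)

PermuteColours : ∀ {n} {G : Graph n} {k} → EdgeColouring G k → EdgeColouring G k → Set
PermuteColours {n} {G} {k} c d =
  Σ (Fin k ↔ Fin k) λ π → ∀ u v (e : Edge G u v) →
    col d u v e ≡ Function.Bundles.Inverse.to π (col c u v e)
  where import Function.Bundles

-- Kempe equivalence: equivalence closure of Kempe changes, with colourings
-- differing by a colour permutation identified.
data KempeEquiv {n} {G : Graph n} {k} : EdgeColouring G k → EdgeColouring G k → Set where
  refl′  : ∀ {c} → KempeEquiv c c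
  kempe  : ∀ {c d e} → KempeChange c d → KempeEquiv d e → KempeEquiv c e
  kempe⁻ : ∀ {c d e} → KempeChange d c → KempeEquiv d e → KempeEquiv c e
  perm   : ∀ {c d e} → PermuteColours c d → KempeEquiv d e → KempeEquiv c e
  ext    : ∀ {c d e} → c ≈c d → KempeEquiv d e → KempeEquiv c e

-- Induction on the degree sum, over subcubic graphs in which every vertex reaches a vertex of
-- degree at most 2; this class is closed under deleting an edge pq at such a vertex p.
-- Every Kempe change of G − pq lifts to a Kempe equivalence of G: if the colour α of pq is not
-- among the swapped colours a, b, then pq keeps α; if both p and q see an a/b edge, their degrees
-- leave a colour outside {a, b} free at both, and pq is first recoloured with it; otherwise one
-- end sees no a/b edge, and pq is swapped exactly when the chain reaches its other end.
-- Lifting an equivalence of the restrictions of two colourings of G makes them agree off pq, and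
-- two such colourings differ by a Kempe change on the edge pq alone.

module Submission where

open import Defs
open import Data.Nat using (ℕ; _≤_; _<_; z≤n; s≤s)
import Data.Nat.Properties as ℕ
import Data.Nat.Induction as ℕ
open import Data.Nat.ListAction using (sum)
open import Data.Fin using (Fin; zero; suc; _≟_)
import Data.Fin.Properties as Fin
open import Data.Bool using (T; true; _∧_; not)
import Data.Bool as Bool
open import Data.Bool.Properties using (T-irrelevant; T-≡; T-∧)
open import Data.List using (List; []; _∷_; length; filter; allFin; lookup; map)
open import Data.List.Membership.Propositional using (_∈_)
open import Data.List.Membership.Propositional.Properties using (∈-filter⁺; ∈-allFin)
open import Data.List.Relation.Unary.Any using (here; there; index)
open import Data.List.Relation.Unary.Any.Properties using (lookup-index)
open import Data.Product using (Σ; ∃; _×_; _,_; proj₁; proj₂)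
open import Data.Sum using (_⊎_; inj₁; inj₂)
open import Data.Empty using (⊥-elim)
open import Function.Bundles using (_↔_; Inverse; Injection; Equivalence; mk⇔)
open import Function.Definitions using (Injective)
open import Function.Properties.Inverse using (↔⇒↣)
open import Relation.Nullary using (¬_; Dec; yes; no)
open import Relation.Nullary.Decidable
  using (does; does-⇔; isYes; isNo; isYes≗does; T?; ¬?; _⊎-dec_; _×-dec_; decidable-stable; ¬¬-excluded-middle;
         toWitness; toWitnessFalse; fromWitnessFalse)
open import Relation.Binary.PropositionalEquality
open import Level using (0ℓ)
open import Induction.WellFounded using (module All)
import Relation.Binary.Construct.On as On

KempeEquivalent : ∀ {n} → Graph n → Set
KempeEquivalent G = ∀ (c d : EdgeColouring G 4) → KempeEquiv c d

OneOf : ∀ {k} → Fin k → Fin k → Fin k → Set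
OneOf a b z = z ≡ a ⊎ z ≡ b

oneOf? : ∀ {k} (a b z : Fin k) → Dec (OneOf a b z)
oneOf? a b z = (z ≟ a) ⊎-dec (z ≟ b)

¬OneOf : ∀ {k} {a b z : Fin k} → ¬ z ≡ a → ¬ z ≡ b → ¬ OneOf a b z
¬OneOf z≢a z≢b (inj₁ z≡a) = z≢a z≡a
¬OneOf z≢a z≢b (inj₂ z≡b) = z≢b z≡b

oneOf-flip : ∀ {k} {a b z : Fin k} → OneOf a b z → OneOf b a z
oneOf-flip (inj₁ z≡a) = inj₂ z≡a
oneOf-flip (inj₂ z≡b) = inj₁ z≡b

module _ {n} {G : Graph n} {k : ℕ} where

  Colouring : Set
  Colouring = EdgeColouring G k

  colour-irrelevant : (c : Colouring) → ∀ u v (e e′ : Edge G u v) → col c u v e ≡ col c u v e′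
  colour-irrelevant c u v e e′ = cong (col c u v) (T-irrelevant e e′)

  distinct-colours⇒distinct-ends : (c : Colouring) → ∀ {u y z} (e : Edge G u y) (e′ : Edge G u z) →
    ¬ col c u y e ≡ col c u z e′ → ¬ y ≡ z
  distinct-colours⇒distinct-ends c {u} e e′ ≢col refl = ≢col (colour-irrelevant c u _ e e′)

  KempeEquiv-trans : {c d f : Colouring} → KempeEquiv c d → KempeEquiv d f → KempeEquiv c f
  KempeEquiv-trans refl′        d~f = d~f
  KempeEquiv-trans (kempe κ c~d)  d~f = kempe κ (KempeEquiv-trans c~d d~f)
  KempeEquiv-trans (kempe⁻ κ c~d) d~f = kempe⁻ κ (KempeEquiv-trans c~d d~f)
  KempeEquiv-trans (perm π c~d)   d~f = perm π (KempeEquiv-trans c~d d~f)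
  KempeEquiv-trans (ext c≈d c~d)  d~f = ext c≈d (KempeEquiv-trans c~d d~f)

  KempeChange⇒KempeEquiv : {c d : Colouring} → KempeChange c d → KempeEquiv c d
  KempeChange⇒KempeEquiv κ = kempe κ refl′

  permute : Fin k ↔ Fin k → Colouring → Colouring
  permute π c = record
    { col     = λ u v e → to (col c u v e)
    ; col-sym = λ u v e e′ → cong to (col-sym c u v e e′)
    ; proper  = λ u v w e e′ v≢w eq → proper c u v w e e′ v≢w (Injection.injective (↔⇒↣ π) eq)
    }
    where open Inverse π

  Sees : Colouring → Fin n → (Fin k → Set) → Set
  Sees c u P = Σ (Fin n) λ y → Σ (Edge G u y) λ e → P (col c u y e)

  sees? : (c : Colouring) (u : Fin n) {P : Fin k → Set} → (∀ z → Dec (P z)) → Dec (Sees c u P)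
  sees? c u {P} P? = Fin.any? at
    where
    at : ∀ y → Dec (Σ (Edge G u y) λ e → P (col c u y e))
    at y with T? (adj G u y)
    ... | no ¬e = no λ (e , _) → ¬e e
    ... | yes e with P? (col c u y e)
    ...   | yes Pe = yes (e , Pe)
    ...   | no ¬Pe = no λ (e′ , Pe′) → ¬Pe (subst P (colour-irrelevant c u y e′ e) Pe′)

  module _ {c : Colouring} {a b : Fin k} where

    ReachAB-snoc : ∀ {x u v} → ReachAB c a b x u → (e : Edge G u v) → OneOf a b (col c u v e) →
      ReachAB c a b x v
    ReachAB-snoc here             e ab = step e ab here
    ReachAB-snoc (step e′ ab′ r) e ab = step e′ ab′ (ReachAB-snoc r e ab)

    ReachAB-flip : ∀ {x u} → ReachAB c a b x u → ReachAB c b a x u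
    ReachAB-flip here           = here
    ReachAB-flip (step e ab r) = step e (oneOf-flip ab) (ReachAB-flip r)

    ReachAB-source-sees : ∀ {x u} → ReachAB c a b x u → u ≡ x ⊎ Sees c x (OneOf a b)
    ReachAB-source-sees here              = inj₁ refl
    ReachAB-source-sees (step {v = y} e ab _) = inj₂ (y , e , ab)

    ReachAB-target-sees : ∀ {x u} → ReachAB c a b x u → u ≡ x ⊎ Sees c u (OneOf a b)
    ReachAB-target-sees here = inj₁ refl
    ReachAB-target-sees {x} (step {v = y} e ab r) with ReachAB-target-sees r
    ... | inj₂ sees = inj₂ sees
    ... | inj₁ refl = inj₂ (x , subst T (symmetric G x y) e , subst (OneOf a b) (col-sym c x y e _) ab)

  SwapClauses : Colouring → Colouring → Fin k → Fin k → Fin n → ∀ u v → Edge G u v → Set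
  SwapClauses c d a b x u v e =
    (ReachAB c a b x u → col c u v e ≡ a → col d u v e ≡ b) ×
    (ReachAB c a b x u → col c u v e ≡ b → col d u v e ≡ a) ×
    ((¬ ReachAB c a b x u ⊎ (¬ col c u v e ≡ a × ¬ col c u v e ≡ b)) → col d u v e ≡ col c u v e)

  module KempeChangeProperties {c d : Colouring} (κ : KempeChange c d) where

    a b : Fin k
    a = proj₁ κ
    b = proj₁ (proj₂ κ)

    x : Fin n
    x = proj₁ (proj₂ (proj₂ κ))

    clauses : ∀ u v e → SwapClauses c d a b x u v e
    clauses = proj₂ (proj₂ (proj₂ κ))

    swap-a : ∀ u v e → ReachAB c a b x u → col c u v e ≡ a → col d u v e ≡ b
    swap-a u v e = proj₁ (clauses u v e)

    swap-b : ∀ u v e → ReachAB c a b x u → col c u v e ≡ b → col d u v e ≡ a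
    swap-b u v e = proj₁ (proj₂ (clauses u v e))

    unchanged-off-component : ∀ u v e → ¬ ReachAB c a b x u → col d u v e ≡ col c u v e
    unchanged-off-component u v e ¬r = proj₂ (proj₂ (clauses u v e)) (inj₁ ¬r)

    unchanged-off-ab : ∀ u v e → ¬ OneOf a b (col c u v e) → col d u v e ≡ col c u v e
    unchanged-off-ab u v e ¬ab = proj₂ (proj₂ (clauses u v e)) (inj₂ ((λ ≡a → ¬ab (inj₁ ≡a)) , (λ ≡b → ¬ab (inj₂ ≡b))))

    oneOf-preserved : ∀ u v e → OneOf a b (col c u v e) → OneOf a b (col d u v e)
    oneOf-preserved u v e ab = decidable-stable (oneOf? a b _) λ ¬ab → ¬¬-excluded-middle λ
      { (yes r) → ¬ab (swapped r ab)
      ; (no ¬r) → ¬ab (subst (OneOf a b) (sym (unchanged-off-component u v e ¬r)) ab) }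
      where
      swapped : ReachAB c a b x u → OneOf a b (col c u v e) → OneOf a b (col d u v e)
      swapped r (inj₁ ≡a) = inj₂ (swap-a u v e r ≡a)
      swapped r (inj₂ ≡b) = inj₁ (swap-b u v e r ≡b)

    oneOf-reflected : ∀ u v e → OneOf a b (col d u v e) → OneOf a b (col c u v e)
    oneOf-reflected u v e ab with oneOf? a b (col c u v e)
    ... | yes abc = abc
    ... | no ¬abc = subst (OneOf a b) (unchanged-off-ab u v e ¬abc) ab

    component-preserved : ∀ {u} → ReachAB c a b x u → ReachAB d a b x u
    component-preserved = extend here here
      where
      extend : ∀ {y u} → ReachAB c a b x y → ReachAB d a b x y → ReachAB c a b y u → ReachAB d a b x u
      extend rc rd here = rd
      extend {y} rc rd (step {v = z} e (inj₁ ≡a) r) =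
        extend (ReachAB-snoc rc e (inj₁ ≡a)) (ReachAB-snoc rd e (inj₂ (swap-a y z e rc ≡a))) r
      extend {y} rc rd (step {v = z} e (inj₂ ≡b) r) =
        extend (ReachAB-snoc rc e (inj₂ ≡b)) (ReachAB-snoc rd e (inj₁ (swap-b y z e rc ≡b))) r

    component-reflected : ∀ {u} → ReachAB d a b x u → ReachAB c a b x u
    component-reflected = extend here
      where
      extend : ∀ {y u} → ReachAB c a b x y → ReachAB d a b y u → ReachAB c a b x u
      extend rc here = rc
      extend {y} rc (step {v = z} e ab r) = extend (ReachAB-snoc rc e (oneOf-reflected y z e ab)) r

  KempeChange-sym : {c d : Colouring} → KempeChange c d → KempeChange d c
  KempeChange-sym {c} {d} κ = a , b , x , λ u v e → back-a u v e , back-b u v e , back-fixed u v e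
    where
    open KempeChangeProperties κ
    back-a : ∀ u v e → ReachAB d a b x u → col d u v e ≡ a → col c u v e ≡ b
    back-a u v e r ≡a with oneOf? a b (col c u v e)
    ... | yes (inj₂ ≡b) = ≡b
    ... | yes (inj₁ c≡a) = trans c≡a (trans (sym ≡a) (swap-a u v e (component-reflected r) c≡a))
    ... | no ¬ab = ⊥-elim (¬ab (inj₁ (trans (sym (unchanged-off-ab u v e ¬ab)) ≡a)))
    back-b : ∀ u v e → ReachAB d a b x u → col d u v e ≡ b → col c u v e ≡ a
    back-b u v e r ≡b with oneOf? a b (col c u v e)
    ... | yes (inj₁ ≡a) = ≡a
    ... | yes (inj₂ c≡b) = trans c≡b (trans (sym ≡b) (swap-b u v e (component-reflected r) c≡b))
    ... | no ¬ab = ⊥-elim (¬ab (inj₂ (trans (sym (unchanged-off-ab u v e ¬ab)) ≡b)))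
    back-fixed : ∀ u v e → (¬ ReachAB d a b x u ⊎ (¬ col d u v e ≡ a × ¬ col d u v e ≡ b)) →
      col c u v e ≡ col d u v e
    back-fixed u v e (inj₁ ¬r) = sym (unchanged-off-component u v e (λ r → ¬r (component-preserved r)))
    back-fixed u v e (inj₂ (≢a , ≢b)) with oneOf? a b (col c u v e)
    ... | no ¬ab = sym (unchanged-off-ab u v e ¬ab)
    ... | yes ab with oneOf-preserved u v e ab
    ...   | inj₁ ≡a = ⊥-elim (≢a ≡a)
    ...   | inj₂ ≡b = ⊥-elim (≢b ≡b)

  KempeChange-flip : {c d : Colouring} → KempeChange c d → KempeChange c d
  KempeChange-flip {c} {d} κ = b , a , x , λ u v e →
    (λ r → swap-b u v e (ReachAB-flip r)) ,
    (λ r → swap-a u v e (ReachAB-flip r)) ,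
    λ { (inj₁ ¬r) → unchanged-off-component u v e (λ r → ¬r (ReachAB-flip r))
      ; (inj₂ (≢b , ≢a)) → unchanged-off-ab u v e (¬OneOf ≢a ≢b) }
    where open KempeChangeProperties {c} {d} κ

  KempeChange-trivial : {c d : Colouring} (κ : KempeChange c d) →
    let open KempeChangeProperties {c} {d} κ in a ≡ b ⊎ ¬ Sees c x (OneOf a b) → d ≈c c
  KempeChange-trivial {c} {d} κ degenerate u v e =
    decidable-stable (col d u v e ≟ col c u v e) λ changed → ¬¬-excluded-middle λ
      { (no ¬r) → changed (unchanged-off-component u v e ¬r)
      ; (yes r) → changed (in-component r degenerate (oneOf? a b (col c u v e))) }
    where
    open KempeChangeProperties {c} {d} κ
    in-component : ReachAB c a b x u → a ≡ b ⊎ ¬ Sees c x (OneOf a b) →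
      Dec (OneOf a b (col c u v e)) → col d u v e ≡ col c u v e
    in-component r _ (no ¬ab) = unchanged-off-ab u v e ¬ab
    in-component r (inj₁ a≡b) (yes (inj₁ ≡a)) = trans (swap-a u v e r ≡a) (trans (sym a≡b) (sym ≡a))
    in-component r (inj₁ a≡b) (yes (inj₂ ≡b)) = trans (swap-b u v e r ≡b) (trans a≡b (sym ≡b))
    in-component r (inj₂ ¬sees) (yes ab) with ReachAB-source-sees r
    ... | inj₂ sees = ⊥-elim (¬sees sees)
    ... | inj₁ refl = ⊥-elim (¬sees (v , e , ab))

length-filter-mono : ∀ {A : Set} {P Q : A → Set} (P? : ∀ x → Dec (P x)) (Q? : ∀ x → Dec (Q x)) →
  (∀ x → P x → Q x) → ∀ xs → length (filter P? xs) ≤ length (filter Q? xs)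
length-filter-mono P? Q? P⇒Q [] = z≤n
length-filter-mono P? Q? P⇒Q (x ∷ xs) with P? x | Q? x
... | yes _  | yes _  = s≤s (length-filter-mono P? Q? P⇒Q xs)
... | yes Px | no ¬Qx = ⊥-elim (¬Qx (P⇒Q x Px))
... | no _   | yes _  = ℕ.m≤n⇒m≤1+n (length-filter-mono P? Q? P⇒Q xs)
... | no _   | no _   = length-filter-mono P? Q? P⇒Q xs

length-filter-mono-< : ∀ {A : Set} {P Q : A → Set} (P? : ∀ x → Dec (P x)) (Q? : ∀ x → Dec (Q x)) →
  (∀ x → P x → Q x) → ∀ {z} xs → z ∈ xs → Q z → ¬ P z → length (filter P? xs) < length (filter Q? xs)
length-filter-mono-< P? Q? P⇒Q (x ∷ xs) (here refl) Qz ¬Pz with P? x | Q? x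
... | yes Px | _      = ⊥-elim (¬Pz Px)
... | no _   | yes _  = s≤s (length-filter-mono P? Q? P⇒Q xs)
... | no _   | no ¬Qx = ⊥-elim (¬Qx Qz)
length-filter-mono-< P? Q? P⇒Q (x ∷ xs) (there z∈xs) Qz ¬Pz with P? x | Q? x
... | yes _  | yes _  = s≤s (length-filter-mono-< P? Q? P⇒Q xs z∈xs Qz ¬Pz)
... | yes Px | no ¬Qx = ⊥-elim (¬Qx (P⇒Q x Px))
... | no _   | yes _  = ℕ.m<n⇒m<1+n (length-filter-mono-< P? Q? P⇒Q xs z∈xs Qz ¬Pz)
... | no _   | no _   = length-filter-mono-< P? Q? P⇒Q xs z∈xs Qz ¬Pz

sum-map-mono : ∀ {A : Set} (f g : A → ℕ) → (∀ x → f x ≤ g x) → ∀ xs → sum (map f xs) ≤ sum (map g xs)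
sum-map-mono f g f≤g []       = z≤n
sum-map-mono f g f≤g (x ∷ xs) = ℕ.+-mono-≤ (f≤g x) (sum-map-mono f g f≤g xs)

sum-map-mono-< : ∀ {A : Set} (f g : A → ℕ) → (∀ x → f x ≤ g x) → ∀ {z} xs → z ∈ xs → f z < g z →
  sum (map f xs) < sum (map g xs)
sum-map-mono-< f g f≤g (x ∷ xs) (here refl)  fz<gz = ℕ.+-mono-<-≤ fz<gz (sum-map-mono f g f≤g xs)
sum-map-mono-< f g f≤g (x ∷ xs) (there z∈xs) fz<gz = ℕ.+-mono-≤-< (f≤g x) (sum-map-mono-< f g f≤g xs z∈xs fz<gz)

module _ {n} (G : Graph n) where

  injection⇒≤degree : ∀ {m} u (f : Fin m → Fin n) → Injective _≡_ _≡_ f → (∀ i → Edge G u (f i)) →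
    m ≤ degree G u
  injection⇒≤degree {m} u f f-inj edge = Fin.injective⇒≤ {f = position} position-inj
    where
    neighbours : List (Fin n)
    neighbours = filter (λ v → adj G u v Bool.≟ true) (allFin n)
    listed : ∀ i → f i ∈ neighbours
    listed i = ∈-filter⁺ _ (∈-allFin (f i)) (Equivalence.to T-≡ (edge i))
    position : Fin m → Fin (length neighbours)
    position i = index (listed i)
    position-inj : Injective _≡_ _≡_ position
    position-inj {i} {j} eq = f-inj (trans (lookup-index (listed i))
      (trans (cong (lookup neighbours) eq) (sym (lookup-index (listed j)))))

  two-neighbours⇒2≤degree : ∀ u {v₀ v₁} → Edge G u v₀ → Edge G u v₁ → ¬ v₀ ≡ v₁ → 2 ≤ degree G u
  two-neighbours⇒2≤degree u {v₀} {v₁} e₀ e₁ v₀≢v₁ = injection⇒≤degree u f f-inj edge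
    where
    f : Fin 2 → Fin n
    f zero       = v₀
    f (suc zero) = v₁
    edge : ∀ i → Edge G u (f i)
    edge zero       = e₀
    edge (suc zero) = e₁
    f-inj : Injective _≡_ _≡_ f
    f-inj {zero}     {zero}     _  = refl
    f-inj {zero}     {suc zero} eq = ⊥-elim (v₀≢v₁ eq)
    f-inj {suc zero} {zero}     eq = ⊥-elim (v₀≢v₁ (sym eq))
    f-inj {suc zero} {suc zero} _  = refl

  three-neighbours⇒3≤degree : ∀ u {v₀ v₁ v₂} → Edge G u v₀ → Edge G u v₁ → Edge G u v₂ →
    ¬ v₀ ≡ v₁ → ¬ v₀ ≡ v₂ → ¬ v₁ ≡ v₂ → 3 ≤ degree G u
  three-neighbours⇒3≤degree u {v₀} {v₁} {v₂} e₀ e₁ e₂ v₀≢v₁ v₀≢v₂ v₁≢v₂ = injection⇒≤degree u f f-inj edge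
    where
    f : Fin 3 → Fin n
    f zero             = v₀
    f (suc zero)       = v₁
    f (suc (suc zero)) = v₂
    edge : ∀ i → Edge G u (f i)
    edge zero             = e₀
    edge (suc zero)       = e₁
    edge (suc (suc zero)) = e₂
    f-inj : Injective _≡_ _≡_ f
    f-inj {zero}             {zero}             _  = refl
    f-inj {zero}             {suc zero}         eq = ⊥-elim (v₀≢v₁ eq)
    f-inj {zero}             {suc (suc zero)}   eq = ⊥-elim (v₀≢v₂ eq)
    f-inj {suc zero}         {zero}             eq = ⊥-elim (v₀≢v₁ (sym eq))
    f-inj {suc zero}         {suc zero}         _  = refl
    f-inj {suc zero}         {suc (suc zero)}   eq = ⊥-elim (v₁≢v₂ eq)
    f-inj {suc (suc zero)}   {zero}             eq = ⊥-elim (v₀≢v₂ (sym eq))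
    f-inj {suc (suc zero)}   {suc zero}         eq = ⊥-elim (v₁≢v₂ (sym eq))
    f-inj {suc (suc zero)}   {suc (suc zero)}   _  = refl

-- Proved by exhaustive evaluation; abstract, so that the check is not re-run wherever it is used.
abstract
  two-colours-outside : (a b : Fin 4) → Σ (Fin 4) λ t₁ → Σ (Fin 4) λ t₂ →
    ¬ t₁ ≡ t₂ × ¬ t₁ ≡ a × ¬ t₁ ≡ b × ¬ t₂ ≡ a × ¬ t₂ ≡ b
  two-colours-outside = toWitness {a? = Fin.all? λ a → Fin.all? λ b → Fin.any? λ t₁ → Fin.any? λ t₂ →
    ¬? (t₁ ≟ t₂) ×-dec ¬? (t₁ ≟ a) ×-dec ¬? (t₁ ≟ b) ×-dec ¬? (t₂ ≟ a) ×-dec ¬? (t₂ ≟ b)} _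

module Deletion {n} (G : Graph n) (p q : Fin n) where

  IsPQ : Fin n → Fin n → Set
  IsPQ u v = (u ≡ p × v ≡ q) ⊎ (u ≡ q × v ≡ p)

  isPQ? : ∀ u v → Dec (IsPQ u v)
  isPQ? u v = ((u ≟ p) ×-dec (v ≟ q)) ⊎-dec ((u ≟ q) ×-dec (v ≟ p))

  IsPQ-sym : ∀ {u v} → IsPQ u v → IsPQ v u
  IsPQ-sym (inj₁ (u≡p , v≡q)) = inj₂ (v≡q , u≡p)
  IsPQ-sym (inj₂ (u≡q , v≡p)) = inj₁ (v≡p , u≡q)

  IsPQ-functional : ∀ {u v w} → IsPQ u v → IsPQ u w → v ≡ w
  IsPQ-functional (inj₁ (refl , refl)) (inj₁ (_ , refl))   = refl
  IsPQ-functional (inj₁ (refl , refl)) (inj₂ (p≡q , refl)) = sym p≡q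
  IsPQ-functional (inj₂ (refl , refl)) (inj₁ (q≡p , refl)) = sym q≡p
  IsPQ-functional (inj₂ (refl , refl)) (inj₂ (_ , refl))   = refl

  isYes-sym : ∀ u v → isYes (isPQ? u v) ≡ isYes (isPQ? v u)
  isYes-sym u v = begin
    isYes (isPQ? u v) ≡⟨ isYes≗does (isPQ? u v) ⟩
    does (isPQ? u v)  ≡⟨ does-⇔ (mk⇔ IsPQ-sym IsPQ-sym) (isPQ? u v) (isPQ? v u) ⟩
    does (isPQ? v u)  ≡⟨ isYes≗does (isPQ? v u) ⟨
    isYes (isPQ? v u) ∎
    where open ≡-Reasoning

  IsPQ-both : (P : Fin n → Set) → ∀ {r o} → IsPQ r o → P r → P o → P p × P q
  IsPQ-both P (inj₁ (refl , refl)) Pr Po = Pr , Po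
  IsPQ-both P (inj₂ (refl , refl)) Pr Po = Po , Pr

  IsPQ-same-ends : ∀ {r o u v} → IsPQ r o → IsPQ u v → (u ≡ r × v ≡ o) ⊎ (u ≡ o × v ≡ r)
  IsPQ-same-ends (inj₁ (refl , refl)) (inj₁ (refl , refl)) = inj₁ (refl , refl)
  IsPQ-same-ends (inj₁ (refl , refl)) (inj₂ (refl , refl)) = inj₂ (refl , refl)
  IsPQ-same-ends (inj₂ (refl , refl)) (inj₁ (refl , refl)) = inj₂ (refl , refl)
  IsPQ-same-ends (inj₂ (refl , refl)) (inj₂ (refl , refl)) = inj₁ (refl , refl)

  G∖pq : Graph n
  G∖pq = record
    { adj         = λ u v → adj G u v ∧ isNo (isPQ? u v)
    ; symmetric   = λ u v → cong₂ _∧_ (symmetric G u v) (cong not (isYes-sym u v))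
    ; irreflexive = λ u → cong (_∧ isNo (isPQ? u u)) (irreflexive G u)
    }

  forget : ∀ {u v} → Edge G∖pq u v → Edge G u v
  forget e = proj₁ (Equivalence.to T-∧ e)

  not-pq : ∀ {u v} → Edge G∖pq u v → ¬ IsPQ u v
  not-pq {u} {v} e = toWitnessFalse {a? = isPQ? u v} (proj₂ (Equivalence.to T-∧ e))

  keep : ∀ {u v} → Edge G u v → ¬ IsPQ u v → Edge G∖pq u v
  keep {u} {v} e ¬pq = Equivalence.from T-∧ (e , fromWitnessFalse {a? = isPQ? u v} ¬pq)

  module _ {k : ℕ} where

    restrict : EdgeColouring G k → EdgeColouring G∖pq k
    restrict c = record
      { col     = λ u v e → col c u v (forget e)
      ; col-sym = λ u v e e′ → col-sym c u v (forget e) (forget e′)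
      ; proper  = λ u v w e e′ → proper c u v w (forget e) (forget e′)
      }

    restrict-colour : (c : EdgeColouring G k) → ∀ u v (e : Edge G u v) (¬pq : ¬ IsPQ u v) →
      col c u v e ≡ col (restrict c) u v (keep e ¬pq)
    restrict-colour c u v e ¬pq = colour-irrelevant c u v e _

    Free : EdgeColouring G∖pq k → Fin n → Fin k → Set
    Free d u t = ∀ y (e : Edge G∖pq u y) → ¬ col d u y e ≡ t

    free : ∀ d {u t} → ¬ Sees d u (_≡ t) → Free d u t
    free d ¬sees y e ≡t = ¬sees (y , e , ≡t)

    module Extend (d : EdgeColouring G∖pq k) (t : Fin k) (free-p : Free d p t) (free-q : Free d q t) where

      free-at-pq : ∀ {u v} → IsPQ u v → Free d u t
      free-at-pq (inj₁ (refl , _)) = free-p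
      free-at-pq (inj₂ (refl , _)) = free-q

      colour : ∀ u v → Edge G u v → Dec (IsPQ u v) → Fin k
      colour u v e (yes _)  = t
      colour u v e (no ¬pq) = col d u v (keep e ¬pq)

      colour-sym : ∀ u v (e : Edge G u v) (e′ : Edge G v u) (pq? : Dec (IsPQ u v)) (qp? : Dec (IsPQ v u)) →
        colour u v e pq? ≡ colour v u e′ qp?
      colour-sym u v e e′ (yes _)  (yes _)  = refl
      colour-sym u v e e′ (yes pq) (no ¬qp) = ⊥-elim (¬qp (IsPQ-sym pq))
      colour-sym u v e e′ (no ¬pq) (yes qp) = ⊥-elim (¬pq (IsPQ-sym qp))
      colour-sym u v e e′ (no _)   (no _)   = col-sym d u v _ _

      colour-proper : ∀ u v w (e : Edge G u v) (e′ : Edge G u w) → ¬ v ≡ w →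
        (pq? : Dec (IsPQ u v)) (pq?′ : Dec (IsPQ u w)) → ¬ colour u v e pq? ≡ colour u w e′ pq?′
      colour-proper u v w e e′ v≢w (yes pq) (yes pq′) _  = v≢w (IsPQ-functional pq pq′)
      colour-proper u v w e e′ v≢w (yes pq) (no ¬pq′) eq = free-at-pq pq w (keep e′ ¬pq′) (sym eq)
      colour-proper u v w e e′ v≢w (no ¬pq) (yes pq′) eq = free-at-pq pq′ v (keep e ¬pq) eq
      colour-proper u v w e e′ v≢w (no _)   (no _)    eq = proper d u v w _ _ v≢w eq

      extend : EdgeColouring G k
      extend = record
        { col     = λ u v e → colour u v e (isPQ? u v)
        ; col-sym = λ u v e e′ → colour-sym u v e e′ (isPQ? u v) (isPQ? v u)
        ; proper  = λ u v w e e′ v≢w → colour-proper u v w e e′ v≢w (isPQ? u v) (isPQ? u w)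
        }

      extend-on-pq : ∀ u v (e : Edge G u v) → IsPQ u v → col extend u v e ≡ t
      extend-on-pq u v e pq with isPQ? u v
      ... | yes _   = refl
      ... | no ¬pq = ⊥-elim (¬pq pq)

      extend-off-pq : ∀ u v (e : Edge G u v) (¬pq : ¬ IsPQ u v) → col extend u v e ≡ col d u v (keep e ¬pq)
      extend-off-pq u v e ¬pq = off (isPQ? u v)
        where
        off : (pq? : Dec (IsPQ u v)) → colour u v e pq? ≡ col d u v (keep e ¬pq)
        off (yes pq) = ⊥-elim (¬pq pq)
        off (no _)   = colour-irrelevant d u v _ _

      restrict-extend : restrict extend ≈c d
      restrict-extend u v e = trans (extend-off-pq u v (forget e) (not-pq e)) (colour-irrelevant d u v _ e)

  degree-∖pq-≤ : ∀ u → degree G∖pq u ≤ degree G u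
  degree-∖pq-≤ u = length-filter-mono _ _ (λ v e → Equivalence.to T-≡ (forget (Equivalence.from T-≡ e))) (allFin n)

  degree-∖pq-< : ∀ {u v} → IsPQ u v → Edge G u v → degree G∖pq u < degree G u
  degree-∖pq-< {u} {v} uv e =
    length-filter-mono-< _ _ (λ w e′ → Equivalence.to T-≡ (forget (Equivalence.from T-≡ e′)))
    (allFin n) (∈-allFin v) (Equivalence.to T-≡ e) λ e′ → not-pq (Equivalence.from T-≡ e′) uv

  Reach-∖pq : ∀ {u z} → Reach G u z → Reach G∖pq u z ⊎ (Reach G∖pq u p ⊎ Reach G∖pq u q)
  Reach-∖pq here = inj₁ here
  Reach-∖pq {u} (step {v = w} e r) with isPQ? u w
  ... | yes (inj₁ (refl , _)) = inj₂ (inj₁ here)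
  ... | yes (inj₂ (refl , _)) = inj₂ (inj₂ here)
  ... | no ¬pq with Reach-∖pq r
  ...   | inj₁ r′         = inj₁ (step (keep e ¬pq) r′)
  ...   | inj₂ (inj₁ r′) = inj₂ (inj₁ (step (keep e ¬pq) r′))
  ...   | inj₂ (inj₂ r′) = inj₂ (inj₂ (step (keep e ¬pq) r′))

  End : Fin n → Set
  End u = u ≡ p ⊎ u ≡ q

  IsPQ-end₁ : ∀ {u v} → IsPQ u v → End u
  IsPQ-end₁ (inj₁ (u≡p , _)) = inj₁ u≡p
  IsPQ-end₁ (inj₂ (u≡q , _)) = inj₂ u≡q

  IsPQ-end₂ : ∀ {u v} → IsPQ u v → End v
  IsPQ-end₂ uv = IsPQ-end₁ (IsPQ-sym uv)

  module WithEdge (epq : Edge G p q) where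

    eqp : Edge G q p
    eqp = subst T (symmetric G p q) epq

    p≢q : ¬ p ≡ q
    p≢q refl = subst T (irreflexive G p) epq

    IsPQ⇒≢ : ∀ {u v} → IsPQ u v → ¬ u ≡ v
    IsPQ⇒≢ (inj₁ (refl , refl)) = p≢q
    IsPQ⇒≢ (inj₂ (refl , refl)) = λ q≡p → p≢q (sym q≡p)

    IsPQ⇒Edge : ∀ {u v} → IsPQ u v → Edge G u v
    IsPQ⇒Edge (inj₁ (refl , refl)) = epq
    IsPQ⇒Edge (inj₂ (refl , refl)) = eqp

    module _ {k : ℕ} where

      colour-on-pq : (c : EdgeColouring G k) → ∀ u v (e : Edge G u v) → IsPQ u v → col c u v e ≡ col c p q epq
      colour-on-pq c u v e (inj₁ (refl , refl)) = colour-irrelevant c u v e epq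
      colour-on-pq c u v e (inj₂ (refl , refl)) = col-sym c q p e epq

      colour-at-end : (c : EdgeColouring G k) → ∀ {y z} → End y → ¬ IsPQ y z → (e : Edge G y z) →
        ¬ col c y z e ≡ col c p q epq
      colour-at-end c (inj₁ refl) ¬pq e eq = proper c p _ q e epq (λ z≡q → ¬pq (inj₁ (refl , z≡q))) eq
      colour-at-end c (inj₂ refl) ¬pq e eq = proper c q _ p e eqp (λ z≡p → ¬pq (inj₂ (refl , z≡p)))
        (trans eq (col-sym c p q epq eqp))

      -- The (α, β)-component of p, for α, β the colours of pq in c and d, is the edge pq alone:
      -- by properness neither colour occurs on another edge at p or q.
      agree-off-pq⇒KempeChange : (c d : EdgeColouring G k) → restrict c ≈c restrict d → KempeChange c d
      agree-off-pq⇒KempeChange c d c≈d = α , β , p , λ u v e → swap-α u v e , swap-β u v e , fixed u v e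
        where
        α β : Fin k
        α = col c p q epq
        β = col d p q epq

        agree : ∀ u v (e : Edge G u v) → ¬ IsPQ u v → col c u v e ≡ col d u v e
        agree u v e ¬pq = trans (restrict-colour c u v e ¬pq)
          (trans (c≈d u v (keep e ¬pq)) (sym (restrict-colour d u v e ¬pq)))

        stays-at-ends : ∀ {y u} → End y → ReachAB c α β y u → End u
        stays-at-ends end here = end
        stays-at-ends {y} end (step {v = z} e αβ r) with isPQ? y z | αβ
        ... | yes (inj₁ (_ , z≡q)) | _     = stays-at-ends (inj₂ z≡q) r
        ... | yes (inj₂ (_ , z≡p)) | _     = stays-at-ends (inj₁ z≡p) r
        ... | no ¬pq | inj₁ ≡α = ⊥-elim (colour-at-end c end ¬pq e ≡α)
        ... | no ¬pq | inj₂ ≡β = ⊥-elim (colour-at-end d end ¬pq e (trans (sym (agree y z e ¬pq)) ≡β))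

        swap-α : ∀ u v e → ReachAB c α β p u → col c u v e ≡ α → col d u v e ≡ β
        swap-α u v e r ≡α with isPQ? u v
        ... | yes on  = colour-on-pq d u v e on
        ... | no ¬pq = ⊥-elim (colour-at-end c (stays-at-ends (inj₁ refl) r) ¬pq e ≡α)

        swap-β : ∀ u v e → ReachAB c α β p u → col c u v e ≡ β → col d u v e ≡ α
        swap-β u v e r ≡β with isPQ? u v
        ... | yes on  = trans (colour-on-pq d u v e on) (trans (sym ≡β) (colour-on-pq c u v e on))
        ... | no ¬pq = ⊥-elim (colour-at-end d (stays-at-ends (inj₁ refl) r) ¬pq e
                                 (trans (sym (agree u v e ¬pq)) ≡β))

        fixed : ∀ u v e → (¬ ReachAB c α β p u ⊎ (¬ col c u v e ≡ α × ¬ col c u v e ≡ β)) →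
          col d u v e ≡ col c u v e
        fixed u v e _ with isPQ? u v
        fixed u v e _                 | no ¬pq                 = sym (agree u v e ¬pq)
        fixed u v e (inj₂ (≢α , _))   | yes on                 = ⊥-elim (≢α (colour-on-pq c u v e on))
        fixed u v e (inj₁ ¬r)         | yes (inj₁ (refl , _)) = ⊥-elim (¬r here)
        fixed u v e (inj₁ ¬r)         | yes (inj₂ (refl , _)) = ⊥-elim (¬r (step epq (inj₁ refl) here))

      Lift : EdgeColouring G k → EdgeColouring G∖pq k → Set
      Lift c d′ = Σ (EdgeColouring G k) λ d → KempeEquiv c d × restrict d ≈c d′

      Lift-prepend : ∀ {c c₁ d′} → KempeEquiv c c₁ → Lift c₁ d′ → Lift c d′
      Lift-prepend c~c₁ (d , c₁~d , d≈d′) = d , KempeEquiv-trans c~c₁ c₁~d , d≈d′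

      module Above (c : EdgeColouring G k) (c′ : EdgeColouring G∖pq k) (c≈c′ : restrict c ≈c c′) where

        α : Fin k
        α = col c p q epq

        colour-off-pq : ∀ u v (e : Edge G u v) (¬pq : ¬ IsPQ u v) → col c u v e ≡ col c′ u v (keep e ¬pq)
        colour-off-pq u v e ¬pq = trans (restrict-colour c u v e ¬pq) (c≈c′ u v (keep e ¬pq))

        α-missing-at-ends : ∀ {u y} → End u → (e : Edge G∖pq u y) → ¬ col c′ u y e ≡ α
        α-missing-at-ends {u} {y} end e eq = colour-at-end c end (not-pq e) (forget e) (trans (c≈c′ u y e) eq)

        reach-lift : ∀ {a b y u} → ReachAB c′ a b y u → ReachAB c a b y u
        reach-lift here = here
        reach-lift {a} {b} {y} (step {v = z} e ab r) =
          step (forget e) (subst (OneOf a b) (sym (c≈c′ y z e)) ab) (reach-lift r)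

        module _ {d′ : EdgeColouring G∖pq k} (κ : KempeChange c′ d′) where
          open KempeChangeProperties {c = c′} {d = d′} κ

          extension-KempeChange : (t : Fin k) (free-p : Free d′ p t) (free-q : Free d′ q t) →
            (∀ u v (e : Edge G u v) → ¬ IsPQ u v → ReachAB c a b x u → OneOf a b (col c u v e) →
              ReachAB c′ a b x u) →
            (∀ u v (e : Edge G u v) → IsPQ u v → SwapClauses c (Extend.extend d′ t free-p free-q) a b x u v e) →
            KempeChange c (Extend.extend d′ t free-p free-q)
          extension-KempeChange t free-p free-q reach-drop on-pq = a , b , x , λ u v e → clauses-at u v e (isPQ? u v)
            where
            open Extend d′ t free-p free-q
            clauses-at : ∀ u v e → Dec (IsPQ u v) → SwapClauses c extend a b x u v e
            clauses-at u v e (yes on)  = on-pq u v e on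
            clauses-at u v e (no ¬pq) =
              (λ r ≡a → trans (extend-off-pq u v e ¬pq)
                (swap-a u v e′ (reach-drop u v e ¬pq r (inj₁ ≡a)) (trans (sym c≡c′) ≡a))) ,
              (λ r ≡b → trans (extend-off-pq u v e ¬pq)
                (swap-b u v e′ (reach-drop u v e ¬pq r (inj₂ ≡b)) (trans (sym c≡c′) ≡b))) ,
              λ h → trans (extend-off-pq u v e ¬pq) (trans (proj₂ (proj₂ (clauses u v e′)) (down h)) (sym c≡c′))
              where
              e′ : Edge G∖pq u v
              e′ = keep e ¬pq
              c≡c′ : col c u v e ≡ col c′ u v e′
              c≡c′ = colour-off-pq u v e ¬pq
              down : (¬ ReachAB c a b x u ⊎ (¬ col c u v e ≡ a × ¬ col c u v e ≡ b)) →
                (¬ ReachAB c′ a b x u ⊎ (¬ col c′ u v e′ ≡ a × ¬ col c′ u v e′ ≡ b))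
              down (inj₁ ¬r)         = inj₁ (λ r → ¬r (reach-lift r))
              down (inj₂ (≢a , ≢b)) = inj₂ ((λ ≡a → ≢a (trans c≡c′ ≡a)) , (λ ≡b → ≢b (trans c≡c′ ≡b)))

          lift-avoiding : ¬ OneOf a b α → Lift c d′
          lift-avoiding α∉ab = extend , KempeChange⇒KempeEquiv change , restrict-extend
            where
            free-at-end : ∀ {u} → End u → Free d′ u α
            free-at-end {u} end y e ≡α with oneOf? a b (col c′ u y e)
            ... | no ¬ab = α-missing-at-ends end e (trans (sym (unchanged-off-ab u y e ¬ab)) ≡α)
            ... | yes ab = α∉ab (subst (OneOf a b) ≡α (oneOf-preserved u y e ab))

            open Extend d′ α (free-at-end (inj₁ refl)) (free-at-end (inj₂ refl))

            reach-drop : ∀ {y u} → ReachAB c a b y u → ReachAB c′ a b y u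
            reach-drop here = here
            reach-drop {y} (step {v = z} e ab r) with isPQ? y z
            ... | yes on  = ⊥-elim (α∉ab (subst (OneOf a b) (colour-on-pq c y z e on) ab))
            ... | no ¬pq = step (keep e ¬pq) (subst (OneOf a b) (colour-off-pq y z e ¬pq) ab) (reach-drop r)

            change : KempeChange c extend
            change = extension-KempeChange α (free-at-end (inj₁ refl)) (free-at-end (inj₂ refl))
              (λ _ _ _ _ r _ → reach-drop r) λ u v e on →
              (λ _ ≡a → ⊥-elim (α∉ab (inj₁ (trans (sym (colour-on-pq c u v e on)) ≡a)))) ,
              (λ _ ≡b → ⊥-elim (α∉ab (inj₂ (trans (sym (colour-on-pq c u v e on)) ≡b)))) ,
              λ _ → trans (extend-on-pq u v e on) (sym (colour-on-pq c u v e on))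

          -- The component of x in c is its component in c′, plus r exactly when that contains o.
          module Blocked (α≡a : α ≡ a) (a≢b : ¬ a ≡ b) (r o : Fin n) (ro : IsPQ r o)
                         (r-blind : ¬ Sees c′ r (OneOf a b)) (x-sees : Sees c′ x (OneOf a b)) where

            r≢o : ¬ r ≡ o
            r≢o = IsPQ⇒≢ ro

            o-end : End o
            o-end = IsPQ-end₂ ro

            a-missing-at-o : ∀ {y} (e : Edge G∖pq o y) → ¬ col c′ o y e ≡ a
            a-missing-at-o e ≡a = α-missing-at-ends o-end e (trans ≡a (sym α≡a))

            ab-at-o-is-b : ∀ {y} (e : Edge G∖pq o y) → OneOf a b (col c′ o y e) → col c′ o y e ≡ b
            ab-at-o-is-b e (inj₁ ≡a) = ⊥-elim (a-missing-at-o e ≡a)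
            ab-at-o-is-b e (inj₂ ≡b) = ≡b

            ab-at-o-was-b : ∀ {y} (e : Edge G∖pq o y) → OneOf a b (col d′ o y e) → col c′ o y e ≡ b
            ab-at-o-was-b {y} e ab = ab-at-o-is-b e (oneOf-reflected o y e ab)

            r-blind-off-pq : ∀ {v} (e : Edge G r v) → ¬ IsPQ r v → ¬ OneOf a b (col c r v e)
            r-blind-off-pq e ¬pq ab = r-blind (_ , keep e ¬pq , subst (OneOf a b) (colour-off-pq r _ e ¬pq) ab)

            r-free : ∀ t → OneOf a b t → Free d′ r t
            r-free t ab y e ≡t = r-blind (y , e , oneOf-reflected r y e (subst (OneOf a b) (sym ≡t) ab))

            -- Reachability of o is not decidable, but an a-edge at o in d′ witnesses it.
            AtO : Set
            AtO = Sees d′ o (_≡ a)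

            τ-for : Dec AtO → Fin k
            τ-for (yes _) = b
            τ-for (no _)  = a

            τ-for-ab : (at? : Dec AtO) → OneOf a b (τ-for at?)
            τ-for-ab (yes _) = inj₂ refl
            τ-for-ab (no _)  = inj₁ refl

            o-free : (at? : Dec AtO) → Free d′ o (τ-for at?)
            o-free (no ¬at) = free d′ ¬at
            o-free (yes (y₁ , e₁ , ≡a)) y e ≡b =
              proper c′ o y₁ y e₁ e (distinct-colours⇒distinct-ends d′ e₁ e λ eq → a≢b (trans (sym ≡a) (trans eq ≡b)))
                (trans (ab-at-o-was-b e₁ (inj₁ ≡a)) (sym (ab-at-o-was-b e (inj₂ ≡b))))

            at? : Dec AtO
            at? = sees? d′ o (_≟ a)

            τ : Fin k
            τ = τ-for at?

            free-ends : Free d′ p τ × Free d′ q τ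
            free-ends = IsPQ-both (λ u → Free d′ u τ) ro (r-free τ (τ-for-ab at?)) (o-free at?)

            open Extend d′ τ (proj₁ free-ends) (proj₂ free-ends)

            x≢r : ¬ x ≡ r
            x≢r refl = r-blind x-sees

            Component : Fin n → Set
            Component u = (ReachAB c′ a b x u × ¬ u ≡ r) ⊎ (u ≡ r × ReachAB c′ a b x o)

            component-step : ∀ {y u} → Component y → ReachAB c a b y u → Component u
            component-step comp here = comp
            component-step {y} comp (step {v = z} e ab rest) with isPQ? y z
            ... | yes on with IsPQ-same-ends ro on | comp
            ...   | inj₁ (refl , refl) | inj₁ (_ , r≢r) = ⊥-elim (r≢r refl)
            ...   | inj₁ (refl , refl) | inj₂ (_ , x⇝o) = component-step (inj₁ (x⇝o , λ o≡r → r≢o (sym o≡r))) rest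
            ...   | inj₂ (refl , refl) | inj₁ (x⇝o , _) = component-step (inj₂ (refl , x⇝o)) rest
            ...   | inj₂ (refl , refl) | inj₂ (_ , x⇝o) = component-step (inj₂ (refl , x⇝o)) rest
            component-step {y} comp (step {v = z} e ab rest) | no ¬pq with comp
            ... | inj₁ (x⇝y , _) = component-step (inj₁ (ReachAB-snoc x⇝y e′ ab′ , z≢r)) rest
              where
              e′ : Edge G∖pq y z
              e′ = keep e ¬pq
              ab′ : OneOf a b (col c′ y z e′)
              ab′ = subst (OneOf a b) (colour-off-pq y z e ¬pq) ab
              z≢r : ¬ z ≡ r
              z≢r refl = r-blind (y , subst T (symmetric G∖pq y z) e′ , subst (OneOf a b) (col-sym c′ y z e′ _) ab′)
            ... | inj₂ (refl , _) = ⊥-elim (r-blind-off-pq e ¬pq ab)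

            component : ∀ {u} → ReachAB c a b x u → Component u
            component = component-step (inj₁ (here , x≢r))

            reached-o⇒AtO : ReachAB c′ a b x o → AtO
            reached-o⇒AtO x⇝o = recoloured (o-sees (ReachAB-target-sees x⇝o))
              where
              o-sees : o ≡ x ⊎ Sees c′ o (OneOf a b) → Sees c′ o (OneOf a b)
              o-sees (inj₁ refl) = x-sees
              o-sees (inj₂ sees) = sees
              recoloured : Sees c′ o (OneOf a b) → AtO
              recoloured (y , e , ab) = y , e , swap-b o y e x⇝o (ab-at-o-is-b e ab)

            τ≡b : ReachAB c′ a b x o → τ ≡ b
            τ≡b x⇝o with at?
            ... | yes _  = refl
            ... | no ¬at = ⊥-elim (¬at (reached-o⇒AtO x⇝o))

            τ≡a : ¬ ReachAB c′ a b x o → τ ≡ a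
            τ≡a ¬x⇝o with at?
            ... | no _               = refl
            ... | yes (y , e , ≡a) = ⊥-elim (a-missing-at-o e (trans (sym (unchanged-off-component o y e ¬x⇝o)) ≡a))

            pq-in-component : ∀ {u v} → IsPQ u v → ReachAB c a b x u → ReachAB c′ a b x o
            pq-in-component uv x⇝u with component x⇝u | IsPQ-same-ends ro uv
            ... | inj₂ (_ , x⇝o)    | _                  = x⇝o
            ... | inj₁ (_ , u≢r)    | inj₁ (refl , _)    = ⊥-elim (u≢r refl)
            ... | inj₁ (x⇝o , _)    | inj₂ (refl , _)    = x⇝o

            o-in-component⇒pq : ∀ {u v} → IsPQ u v → ReachAB c′ a b x o → ReachAB c a b x u
            o-in-component⇒pq uv x⇝o with IsPQ-same-ends ro uv
            ... | inj₁ (refl , _) =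
              ReachAB-snoc (reach-lift x⇝o) eor (inj₁ (trans (colour-on-pq c _ _ eor (IsPQ-sym ro)) α≡a))
              where
              eor : Edge G o r
              eor = IsPQ⇒Edge (IsPQ-sym ro)
            ... | inj₂ (refl , _) = reach-lift x⇝o

            change : KempeChange c extend
            change = extension-KempeChange τ (proj₁ free-ends) (proj₂ free-ends) reach-drop λ u v e on →
              (λ x⇝u ≡a → trans (extend-on-pq u v e on) (τ≡b (pq-in-component on x⇝u))) ,
              (λ _ ≡b → ⊥-elim (a≢b (trans (sym α≡a) (trans (sym (colour-on-pq c u v e on)) ≡b)))) ,
              λ { (inj₂ (≢a , _)) → ⊥-elim (≢a (trans (colour-on-pq c u v e on) α≡a))
                ; (inj₁ ¬x⇝u) → trans (extend-on-pq u v e on) (trans (τ≡a (λ x⇝o → ¬x⇝u (o-in-component⇒pq on x⇝o)))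
                                  (sym (trans (colour-on-pq c u v e on) α≡a))) }
              where
              reach-drop : ∀ u v (e : Edge G u v) → ¬ IsPQ u v → ReachAB c a b x u → OneOf a b (col c u v e) →
                ReachAB c′ a b x u
              reach-drop u v e ¬pq x⇝u ab with component x⇝u
              ... | inj₁ (x⇝u′ , _) = x⇝u′
              ... | inj₂ (refl , _) = ⊥-elim (r-blind-off-pq e ¬pq ab)

            lift-blocked : Lift c d′
            lift-blocked = extend , KempeChange⇒KempeEquiv change , restrict-extend

    module _ (deg-p : degree G p ≤ 2) (deg-q : degree G q ≤ 3) where

      module _ (c′ : EdgeColouring G∖pq 4) {a b : Fin 4} where

        p-sees-no-third : Sees c′ p (OneOf a b) → ∀ {t} → ¬ OneOf a b t → ¬ Sees c′ p (_≡ t)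
        p-sees-no-third (y₁ , e₁ , ab) t∉ab (y₂ , e₂ , ≡t) =
          ℕ.<⇒≱ (ℕ.<-≤-trans (degree-∖pq-< (inj₁ (refl , refl)) epq) deg-p)
                (two-neighbours⇒2≤degree G∖pq p e₁ e₂ y₁≢y₂)
          where
          y₁≢y₂ : ¬ y₁ ≡ y₂
          y₁≢y₂ = distinct-colours⇒distinct-ends c′ e₁ e₂ λ eq → t∉ab (subst (OneOf a b) (trans eq ≡t) ab)

        q-sees-no-third-and-fourth : Sees c′ q (OneOf a b) → ∀ {t₁ t₂} → ¬ t₁ ≡ t₂ →
          ¬ OneOf a b t₁ → ¬ OneOf a b t₂ → Sees c′ q (_≡ t₁) → ¬ Sees c′ q (_≡ t₂)
        q-sees-no-third-and-fourth (y₁ , e₁ , ab) t₁≢t₂ t₁∉ab t₂∉ab (y₂ , e₂ , ≡t₁) (y₃ , e₃ , ≡t₂) =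
          ℕ.<⇒≱ (ℕ.<-≤-trans (degree-∖pq-< (inj₂ (refl , refl)) eqp) deg-q)
                (three-neighbours⇒3≤degree G∖pq q e₁ e₂ e₃ y₁≢y₂ y₁≢y₃ y₂≢y₃)
          where
          y₁≢y₂ : ¬ y₁ ≡ y₂
          y₁≢y₂ = distinct-colours⇒distinct-ends c′ e₁ e₂ λ eq → t₁∉ab (subst (OneOf a b) (trans eq ≡t₁) ab)
          y₁≢y₃ : ¬ y₁ ≡ y₃
          y₁≢y₃ = distinct-colours⇒distinct-ends c′ e₁ e₃ λ eq → t₂∉ab (subst (OneOf a b) (trans eq ≡t₂) ab)
          y₂≢y₃ : ¬ y₂ ≡ y₃
          y₂≢y₃ = distinct-colours⇒distinct-ends c′ e₂ e₃ λ eq → t₁≢t₂ (trans (sym ≡t₁) (trans eq ≡t₂))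

        common-free-colour : Sees c′ p (OneOf a b) → Sees c′ q (OneOf a b) →
          Σ (Fin 4) λ t → ¬ OneOf a b t × Free c′ p t × Free c′ q t
        common-free-colour p-ab q-ab with two-colours-outside a b
        ... | t₁ , t₂ , t₁≢t₂ , t₁≢a , t₁≢b , t₂≢a , t₂≢b with sees? c′ q (_≟ t₁)
        ...   | no ¬q-t₁ = t₁ , t₁∉ab , free c′ (p-sees-no-third p-ab t₁∉ab) , free c′ ¬q-t₁
          where t₁∉ab = ¬OneOf t₁≢a t₁≢b
        ...   | yes q-t₁ = t₂ , t₂∉ab , free c′ (p-sees-no-third p-ab t₂∉ab) ,
                           free c′ (q-sees-no-third-and-fourth q-ab t₁≢t₂ (¬OneOf t₁≢a t₁≢b) t₂∉ab q-t₁)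
          where t₂∉ab = ¬OneOf t₂≢a t₂≢b

      module _ (c : EdgeColouring G 4) {c′ d′ : EdgeColouring G∖pq 4} (c≈c′ : restrict c ≈c c′)
               (κ : KempeChange c′ d′) where
        open KempeChangeProperties {c = c′} {d = d′} κ
        open Above c c′ c≈c′ using (α; lift-avoiding; module Blocked)

        lift-unchanged : a ≡ b ⊎ ¬ Sees c′ x (OneOf a b) → Lift c d′
        lift-unchanged trivial =
          c , refl′ , λ u v e → trans (c≈c′ u v e) (sym (KempeChange-trivial {c = c′} {d = d′} κ trivial u v e))

        lift-KempeChange-α≡a : α ≡ a → Lift c d′
        lift-KempeChange-α≡a α≡a with a ≟ b | sees? c′ x (oneOf? a b)
        ... | yes a≡b | _        = lift-unchanged (inj₁ a≡b)
        ... | no _    | no ¬sees = lift-unchanged (inj₂ ¬sees)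
        ... | no a≢b  | yes x-sees with sees? c′ p (oneOf? a b) | sees? c′ q (oneOf? a b)
        ...   | no ¬p-ab | _        = Blocked.lift-blocked {d′ = d′} κ α≡a a≢b p q (inj₁ (refl , refl)) ¬p-ab x-sees
        ...   | yes _    | no ¬q-ab = Blocked.lift-blocked {d′ = d′} κ α≡a a≢b q p (inj₂ (refl , refl)) ¬q-ab x-sees
        ...   | yes p-ab | yes q-ab with common-free-colour c′ p-ab q-ab
        ...     | t , t∉ab , free-p , free-q =
          Lift-prepend {d′ = d′} (KempeChange⇒KempeEquiv recolour)
            (Above.lift-avoiding extend c′ restrict-extend {d′ = d′} κ t∉ab′)
          where
          open Extend c′ t free-p free-q
          recolour : KempeChange c extend
          recolour = agree-off-pq⇒KempeChange c extend λ u v e → trans (c≈c′ u v e) (sym (restrict-extend u v e))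
          t∉ab′ : ¬ OneOf a b (col extend p q epq)
          t∉ab′ ab = t∉ab (subst (OneOf a b) (extend-on-pq p q epq (inj₁ (refl , refl))) ab)

      lift-KempeChange : ∀ c {c′ d′ : EdgeColouring G∖pq 4} → restrict c ≈c c′ → KempeChange c′ d′ → Lift c d′
      lift-KempeChange c {c′} {d′} c≈c′ κ with oneOf? (proj₁ κ) (proj₁ (proj₂ κ)) (col c p q epq)
      ... | no α∉ab         = Above.lift-avoiding c c′ c≈c′ {d′ = d′} κ α∉ab
      ... | yes (inj₁ α≡a) = lift-KempeChange-α≡a c {c′} {d′} c≈c′ κ α≡a
      ... | yes (inj₂ α≡b) = lift-KempeChange-α≡a c {c′} {d′} c≈c′ (KempeChange-flip {c = c′} {d = d′} κ) α≡b

      lift-KempeEquiv : ∀ {c′ e′ : EdgeColouring G∖pq 4} → KempeEquiv c′ e′ → ∀ c → restrict c ≈c c′ → Lift c e′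
      lift-KempeChange-then : ∀ {c′ d′ e′ : EdgeColouring G∖pq 4} → KempeChange c′ d′ → KempeEquiv d′ e′ →
        ∀ c → restrict c ≈c c′ → Lift c e′

      lift-KempeEquiv refl′ c c≈c′ = c , refl′ , c≈c′
      lift-KempeEquiv (kempe κ d′~e′) c c≈c′ = lift-KempeChange-then κ d′~e′ c c≈c′
      lift-KempeEquiv {c′} (kempe⁻ {d = d′} κ d′~e′) c c≈c′ =
        lift-KempeChange-then (KempeChange-sym {c = d′} {d = c′} κ) d′~e′ c c≈c′
      lift-KempeEquiv (perm {d = d′} (π , πc′≡d′) d′~e′) c c≈c′
        with lift-KempeEquiv d′~e′ (permute π c)
               (λ u v e → trans (cong (Inverse.to π) (c≈c′ u v e)) (sym (πc′≡d′ u v e)))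
      ... | e , πc~e , e≈e′ = e , perm (π , λ _ _ _ → refl) πc~e , e≈e′
      lift-KempeEquiv (ext c′≈d′ d′~e′) c c≈c′ = lift-KempeEquiv d′~e′ c λ u v e → trans (c≈c′ u v e) (c′≈d′ u v e)

      lift-KempeChange-then {c′} {d′} {e′} κ d′~e′ c c≈c′ with lift-KempeChange c {c′} {d′} c≈c′ κ
      ... | d , c~d , d≈d′ = Lift-prepend {d′ = e′} c~d (lift-KempeEquiv d′~e′ d d≈d′)

      KempeEquivalent-∖pq⇒KempeEquivalent : KempeEquivalent G∖pq → KempeEquivalent G
      KempeEquivalent-∖pq⇒KempeEquivalent all-equiv c d
        with lift-KempeEquiv (all-equiv (restrict c) (restrict d)) c (λ _ _ _ → refl)
      ... | c₁ , c~c₁ , c₁≈d = KempeEquiv-trans c~c₁ (KempeChange⇒KempeEquiv (agree-off-pq⇒KempeChange c₁ d c₁≈d))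

Subcubic : ∀ {n} → Graph n → Set
Subcubic {n} G = ∀ (v : Fin n) → degree G v ≤ 3

LowVertexInEveryComponent : ∀ {n} → Graph n → Set
LowVertexInEveryComponent {n} G = ∀ (u : Fin n) → Σ (Fin n) λ v → Reach G u v × degree G v ≤ 2

degreeSum : ∀ {n} → Graph n → ℕ
degreeSum {n} G = sum (map (degree G) (allFin n))

module _ {n} (G : Graph n) where

  has-edge? : Dec (Σ (Fin n) λ u → Σ (Fin n) λ v → Edge G u v)
  has-edge? = Fin.any? λ u → Fin.any? λ v → T? (adj G u v)

  edgeless⇒KempeEquivalent : ¬ (Σ (Fin n) λ u → Σ (Fin n) λ v → Edge G u v) → KempeEquivalent G
  edgeless⇒KempeEquivalent edgeless c d = ext (λ u v e → ⊥-elim (edgeless (u , v , e))) refl′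

  Reach⇒edge-at-target : ∀ {u x v} → Reach G u x → Edge G u v → Σ (Fin n) λ y → Edge G x y
  Reach⇒edge-at-target {v = v} here e = v , e
  Reach⇒edge-at-target {u} (step {v = w} e′ r) e = Reach⇒edge-at-target r (subst T (symmetric G u w) e′)

  module _ {p q : Fin n} (epq : Edge G p q) where
    open Deletion G p q

    degreeSum-∖pq : degreeSum G∖pq < degreeSum G
    degreeSum-∖pq = sum-map-mono-< (degree G∖pq) (degree G) degree-∖pq-≤ (allFin n) (∈-allFin p)
      (degree-∖pq-< (inj₁ (refl , refl)) epq)

    Subcubic-∖pq : Subcubic G → Subcubic G∖pq
    Subcubic-∖pq subcubic v = ℕ.≤-trans (degree-∖pq-≤ v) (subcubic v)

    -- A vertex that loses its path to a low vertex still reaches p or q, whose degree drops.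
    LowVertexInEveryComponent-∖pq : Subcubic G → LowVertexInEveryComponent G → degree G p ≤ 2 →
      LowVertexInEveryComponent G∖pq
    LowVertexInEveryComponent-∖pq subcubic low deg-p u with low u
    ... | z , rz , deg-z with Reach-∖pq rz
    ...   | inj₁ r′         = z , r′ , ℕ.≤-trans (degree-∖pq-≤ z) deg-z
    ...   | inj₂ (inj₁ r′) = p , r′ , ℕ.≤-trans (degree-∖pq-≤ p) deg-p
    ...   | inj₂ (inj₂ r′) = q , r′ , ℕ.≤-pred (ℕ.<-≤-trans (degree-∖pq-< (inj₂ (refl , refl)) eqp) (subcubic q))
      where open WithEdge epq using (eqp)

subcubic⇒KempeEquivalent : ∀ {n} (G : Graph n) → Subcubic G → LowVertexInEveryComponent G → KempeEquivalent G
subcubic⇒KempeEquivalent {n} = All.wfRec (On.wellFounded degreeSum ℕ.<-wellFounded) 0ℓ P induction-step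
  where
  P : Graph n → Set
  P G = Subcubic G → LowVertexInEveryComponent G → KempeEquivalent G

  induction-step : ∀ G → (∀ {G′} → degreeSum G′ < degreeSum G → P G′) → P G
  induction-step G ih subcubic low with has-edge? G
  ... | no edgeless = edgeless⇒KempeEquivalent G edgeless
  ... | yes (u , v , e) with low u
  ...   | p , rp , deg-p with Reach⇒edge-at-target G rp e
  ...     | q , epq = WithEdge.KempeEquivalent-∖pq⇒KempeEquivalent epq deg-p (subcubic q)
                        (ih (degreeSum-∖pq G epq) (Subcubic-∖pq G epq subcubic)
                            (LowVertexInEveryComponent-∖pq G epq subcubic low deg-p))
    where open Deletion G p q

lemma7 : ∀ {n} (G : Graph n) → Connected G → (∀ v → degree G v ≤ 3) →
    ∃ (λ v → degree G v ≤ 2) → (c d : EdgeColouring G 4) → KempeEquiv c d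
lemma7 G connected subcubic (v , deg-v) = subcubic⇒KempeEquivalent G subcubic λ u → v , connected u v , deg-v
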